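{- Consider the online facility assignment problem on an equilateral triangle with side length $S$, with three facilities at the three vertices, each of capacity $2$, and at most $6$ customers appearing one at a time on the boundary of the triangle. The competitive ratio of the greedy algorithm is at most $5$.
   Context: Online facility assignment: customers arrive sequentially at points on the boundary and must each be assigned irrevocably on arrival to a facility with remaining capacity; the cost of assigning a customer to a facility is their distance (measured along the boundary), and the total cost is the sum of assignment costs. The greedy algorithm assigns each arriving customer to the nearest facility that still has remaining capacity. The competitive ratio of the greedy algorithm is the supremum, over input sequences $I$, of $\mathrm{Cost}_{Greedy}(I)/\mathrm{Cost}_{OPT}(I)$, where $\mathrm{Cost}_{OPT}(I)$ is the minimum total cost of a capacity-respecting assignment computed with full knowledge of $I$.
   Formalization: The side length S and the positions of the customers on the boundary of the triangle are rational. -}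

module Defs where

open import Data.Nat using (ℕ; zero; suc)
import Data.Nat as ℕ
open import Data.Integer using (+_)
open import Data.Fin using (Fin; toℕ)
open import Data.Fin.Properties using (_≟_)
open import Data.List using (List; []; _∷_; length)
open import Data.Product using (_×_)
open import Data.Unit using (⊤)
open import Data.Empty using (⊥)
open import Relation.Nullary using (yes; no)
open import Data.Rational using (ℚ; _+_; _*_; _-_; ∣_∣; _⊓_; _≤_; _/_; 0ℚ)

ℚ[_] : ℕ → ℚ
ℚ[ n ] = + n / 1

-- The boundary of the equilateral triangle with side S is a cycle of
-- length 3S; a point is a coordinate p with 0 ≤ p < 3S (arc length from
-- vertex 0).
facilityPos : ℚ → Fin 3 → ℚ
facilityPos S f = ℚ[ toℕ f ] * S

bdist : ℚ → ℚ → ℚ → ℚ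
bdist S p q = ∣ p - q ∣ ⊓ (ℚ[ 3 ] * S - ∣ p - q ∣)

load : Fin 3 → List (Fin 3) → ℕ
load f [] = 0
load f (g ∷ gs) with f ≟ g
... | yes _ = suc (load f gs)
... | no _ = load f gs

capacity : ℕ
capacity = 2

Available : List (Fin 3) → Fin 3 → Set
Available hist f = load f hist ℕ.< capacity

IsGreedy : ℚ → List (Fin 3) → List ℚ → List (Fin 3) → Set
IsGreedy S hist [] [] = ⊤
IsGreedy S hist [] (_ ∷ _) = ⊥
IsGreedy S hist (_ ∷ _) [] = ⊥
IsGreedy S hist (x ∷ xs) (f ∷ fs) =
  Available hist f
  × ((g : Fin 3) → Available hist g →
       bdist S x (facilityPos S f) ≤ bdist S x (facilityPos S g))
  × IsGreedy S (f ∷ hist) xs fs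

Feasible : List (Fin 3) → Set
Feasible fs = (f : Fin 3) → load f fs ℕ.≤ capacity

cost : ℚ → List ℚ → List (Fin 3) → ℚ
cost S (x ∷ xs) (f ∷ fs) = bdist S x (facilityPos S f) + cost S xs fs
cost S _ _ = 0ℚ

OnBoundary : ℚ → ℚ → Set
OnBoundary S x = (0ℚ ≤ x) × (x Data.Rational.< ℚ[ 3 ] * S)

{- A point of the boundary lies on a side, at distance t ∈ [0, S] from one end, so its distances
   to the three vertices are t, S - t and S + min(t, S - t). Hence either one vertex is strictly
   nearest and all others are at distance ≥ S/2, or the point is the midpoint of a side and both
   ends of that side are nearest, at distance S/2. Writing r for the distance to a nearest vertex,
   every vertex is within r + S. So greedy pays at most r, plus S when it has to detour away from
   the nearest vertices, while any assignment pays at least r, and at least S/2 when the vertex it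
   uses is "costly" (not a unique nearest one).

   The counting fact behind the ratio 5 is that, with capacity 2, greedy makes at most twice as
   many detours as the optimum makes costly assignments. It is certified by a potential ψ on the
   load vectors of the two assignments, with ψ = 0 initially and
     [detour] + ψ' ≤ 2 [costly] + ψ   at every step.
   Then dist(greedy) + S ψ' ≤ r + S (2 [costly] + ψ) ≤ 5 dist(optimum) + S ψ for each customer,
   and summing over the customers gives the theorem. -}
module Submission where

open import Defs
open import Data.Bool using (Bool; true; false; not; T)
open import Data.Bool.Properties using (not-involutive)
open import Data.Empty using (⊥-elim)
open import Data.Fin using (Fin; zero; suc; toℕ)
open import Data.Fin.Properties using (_≟_; all?)
open import Data.List using (List; []; _∷_; length)
open import Data.List.Relation.Unary.All using (All; []; _∷_)
open import Data.Nat using (ℕ; zero; suc; z≤n; s≤s)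
import Data.Nat as ℕ
import Data.Nat.Properties as ℕ
open import Data.Nat.DivMod using (_/_; _%_)
open import Data.Product using (Σ; _×_; _,_; proj₁; proj₂)
open import Data.Rational using (ℚ; 0ℚ; _+_; _-_; -_; _*_; _≤_; _<_; _⊓_; ∣_∣)
open import Data.Rational.Properties
  using ( +-identityˡ; +-identityʳ; +-inverseʳ; +-comm; +-assoc; +-mono-≤; +-monoˡ-≤; +-monoʳ-≤
        ; +-monoˡ-<; ≤-refl; ≤-reflexive; ≤-trans; ≤-total; <⇒≤; <-≤-trans; <-irrefl; <-cmp
        ; p≤q⇒p⊓q≡p; p≥q⇒p⊓q≡q; ⊓-idem; ⊓-comm; 0≤p⇒∣p∣≡p; ∣-p∣≡∣p∣; +-*-commutativeRing
        ; +-0-monoid; module ≤-Reasoning )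
  renaming (_≟_ to _≟ℚ_)
open import Algebra.Properties.Monoid.Mult +-0-monoid using (×-homo-+) renaming (_×_ to _·_)
open import Data.Sum using (_⊎_; inj₁; inj₂)
open import Data.Unit using (tt)
open import Function using (_∘_)
open import Level using (0ℓ)
open import Relation.Binary.Definitions using (tri<; tri≈; tri>)
open import Relation.Binary.PropositionalEquality
  using (_≡_; _≢_; refl; sym; trans; cong; cong₂; subst; module ≡-Reasoning)
open import Relation.Nullary using (yes; no)
open import Relation.Nullary.Decidable
  using (Dec; isYes; isNo; toWitness; toWitnessFalse; map′; _×-dec_; _→-dec_; T?; dec⇒maybe)
open import Relation.Unary using (Decidable)
open import Tactic.RingSolver using (solve-∀)
import Tactic.RingSolver.Core.AlmostCommutativeRing as ACR

ℚ-ring : ACR.AlmostCommutativeRing 0ℓ 0ℓ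
ℚ-ring = ACR.fromCommutativeRing +-*-commutativeRing (dec⇒maybe ∘ (0ℚ ≟ℚ_))

p≤p+q : ∀ {p q} → 0ℚ ≤ q → p ≤ p + q
p≤p+q {p} {q} 0≤q = subst (_≤ p + q) (+-identityʳ p) (+-monoʳ-≤ p 0≤q)

p≤q+p : ∀ {p q} → 0ℚ ≤ q → p ≤ q + p
p≤q+p {p} {q} 0≤q = subst (_≤ q + p) (+-identityˡ p) (+-monoˡ-≤ p 0≤q)

p<q+p : ∀ {p q} → 0ℚ < q → p < q + p
p<q+p {p} {q} 0<q = subst (_< q + p) (+-identityˡ p) (+-monoˡ-< p 0<q)

≤-witness : ∀ {p q e} → 0ℚ ≤ e → q ≡ p + e → p ≤ q
≤-witness 0≤e refl = p≤p+q 0≤e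

0≤q-p : ∀ {p q} → p ≤ q → 0ℚ ≤ q - p
0≤q-p {p} {q} p≤q = subst (_≤ q - p) (+-inverseʳ p) (+-monoˡ-≤ (- p) p≤q)

p-q≤r : ∀ {p q r} → p ≤ q + r → p - q ≤ r
p-q≤r {p} {q} {r} p≤q+r = ≤-trans (+-monoˡ-≤ (- q) p≤q+r) (≤-reflexive (eq q r))
  where
  eq : ∀ q r → (q + r) - q ≡ r
  eq = solve-∀ ℚ-ring

q-p≤q : ∀ {p q} → 0ℚ ≤ p → q - p ≤ q
q-p≤q {p} {q} 0≤p = ≤-witness 0≤p (eq p q)
  where
  eq : ∀ p q → q ≡ (q - p) + p
  eq = solve-∀ ℚ-ring

data Kind : Set where
  unique   : Fin 3 → Kind
  -- the customer is the midpoint of the side opposite this vertex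
  midpoint : Fin 3 → Kind

near : Kind → Fin 3 → Bool
near (unique f)   g = isYes (g ≟ f)
near (midpoint f) g = isNo (g ≟ f)

costly : Kind → Fin 3 → Bool
costly (unique f)   g = isNo (g ≟ f)
costly (midpoint f) g = true

record Profile (S : ℚ) (d : Fin 3 → ℚ) (k : Kind) : Set where
  field
    radius       : ℚ
    0≤radius     : 0ℚ ≤ radius
    near⇒≡radius : ∀ f → T (near k f) → d f ≡ radius
    far⇒radius<  : ∀ f → T (not (near k f)) → radius < d f
    ≤radius+S    : ∀ f → d f ≤ radius + S
    costly⇒S≤d+d : ∀ f → T (costly k f) → S ≤ d f + d f

Covers : Fin 3 → Fin 3 → Fin 3 → Set
Covers p q r = ∀ f → f ≡ p ⊎ f ≡ q ⊎ f ≡ r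

Covers-swap : ∀ {p q r} → Covers p q r → Covers q p r
Covers-swap cover f with cover f
... | inj₁ f≡p        = inj₂ (inj₁ f≡p)
... | inj₂ (inj₁ f≡q) = inj₁ f≡q
... | inj₂ (inj₂ f≡r) = inj₂ (inj₂ f≡r)

module _ {S : ℚ} (0<S : 0ℚ < S) {d : Fin 3 → ℚ} where

  private
    0≤S : 0ℚ ≤ S
    0≤S = <⇒≤ 0<S

  record FarVertex (ρ e : ℚ) : Set where
    field
      ρ<e   : ρ < e
      e≤ρ+S : e ≤ ρ + S
      S≤e+e : S ≤ e + e

  farVertex : ∀ {ρ e} → 0ℚ ≤ ρ → e ≡ S + ρ → FarVertex ρ e
  farVertex {ρ} 0≤ρ refl = record
    { ρ<e   = p<q+p 0<S
    ; e≤ρ+S = ≤-reflexive (+-comm S ρ)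
    ; S≤e+e = ≤-trans (p≤p+q 0≤ρ) (p≤p+q (+-mono-≤ 0≤S 0≤ρ))
    }

  uniqueProfile : ∀ {p q r} → Covers p q r → 0ℚ ≤ d p → d p + d q ≡ S → d p < d q → d r ≡ S + d p →
                  Profile S d (unique p)
  uniqueProfile {p} {q} cover 0≤dp dp+dq≡S dp<dq dr≡S+dp = record
    { radius       = d p
    ; 0≤radius     = 0≤dp
    ; near⇒≡radius = λ f f≡p → cong d (toWitness f≡p)
    ; far⇒radius<  = λ f f≢p → beyond f (toWitnessFalse f≢p)
    ; ≤radius+S    = within
    ; costly⇒S≤d+d = λ f f≢p → atLeastHalf f (toWitnessFalse f≢p)
    }
    where
    open FarVertex (farVertex 0≤dp dr≡S+dp)

    beyond : ∀ f → f ≢ p → d p < d f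
    beyond f f≢p with cover f
    ... | inj₁ refl        = ⊥-elim (f≢p refl)
    ... | inj₂ (inj₁ refl) = dp<dq
    ... | inj₂ (inj₂ refl) = ρ<e

    within : ∀ f → d f ≤ d p + S
    within f with cover f
    ... | inj₁ refl        = p≤p+q 0≤S
    ... | inj₂ (inj₁ refl) = ≤-trans (≤-trans (p≤q+p 0≤dp) (≤-reflexive dp+dq≡S)) (p≤q+p 0≤dp)
    ... | inj₂ (inj₂ refl) = e≤ρ+S

    atLeastHalf : ∀ f → f ≢ p → S ≤ d f + d f
    atLeastHalf f f≢p with cover f
    ... | inj₁ refl        = ⊥-elim (f≢p refl)
    ... | inj₂ (inj₁ refl) = ≤-trans (≤-reflexive (sym dp+dq≡S)) (+-monoˡ-≤ (d q) (<⇒≤ dp<dq))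
    ... | inj₂ (inj₂ refl) = S≤e+e

  midpointProfile : ∀ {p q r} → Covers p q r → 0ℚ ≤ d p → d p + d q ≡ S → d p ≡ d q → d r ≡ S + d p →
                    Profile S d (midpoint r)
  midpointProfile {p} {r = r} cover 0≤dp dp+dq≡S dp≡dq dr≡S+dp = record
    { radius       = d p
    ; 0≤radius     = 0≤dp
    ; near⇒≡radius = λ f f≢r → tied f (toWitnessFalse f≢r)
    ; far⇒radius<  = λ f f≡r → beyond f (toWitness (subst T (not-involutive _) f≡r))
    ; ≤radius+S    = within
    ; costly⇒S≤d+d = λ f _ → atLeastHalf f
    }
    where
    open FarVertex (farVertex 0≤dp dr≡S+dp)

    tied : ∀ f → f ≢ r → d f ≡ d p
    tied f f≢r with cover f
    ... | inj₁ refl        = refl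
    ... | inj₂ (inj₁ refl) = sym dp≡dq
    ... | inj₂ (inj₂ refl) = ⊥-elim (f≢r refl)

    beyond : ∀ f → f ≡ r → d p < d f
    beyond f refl = ρ<e

    within : ∀ f → d f ≤ d p + S
    within f with cover f
    ... | inj₁ refl        = p≤p+q 0≤S
    ... | inj₂ (inj₁ refl) = subst (_≤ d p + S) dp≡dq (p≤p+q 0≤S)
    ... | inj₂ (inj₂ refl) = e≤ρ+S

    S≤dp+dp : S ≤ d p + d p
    S≤dp+dp = ≤-reflexive (trans (sym dp+dq≡S) (cong (d p +_) (sym dp≡dq)))

    atLeastHalf : ∀ f → S ≤ d f + d f
    atLeastHalf f with cover f
    ... | inj₁ refl        = S≤dp+dp
    ... | inj₂ (inj₁ refl) = subst (λ z → S ≤ z + z) dp≡dq S≤dp+dp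
    ... | inj₂ (inj₂ refl) = S≤e+e

  sideProfile : ∀ {p q r} → Covers p q r → 0ℚ ≤ d p → 0ℚ ≤ d q → d p + d q ≡ S →
                d r ≡ (S + d p) ⊓ (S + d q) → Σ Kind (Profile S d)
  sideProfile {p} {q} cover 0≤dp 0≤dq dp+dq≡S dr≡min with <-cmp (d p) (d q)
  ... | tri< dp<dq _ _ =
    unique p , uniqueProfile cover 0≤dp dp+dq≡S dp<dq
                 (trans dr≡min (p≤q⇒p⊓q≡p (+-monoʳ-≤ S (<⇒≤ dp<dq))))
  ... | tri≈ _ dp≡dq _ =
    midpoint _ , midpointProfile cover 0≤dp dp+dq≡S dp≡dq
                   (trans dr≡min (trans (cong (λ z → (S + d p) ⊓ (S + z)) (sym dp≡dq)) (⊓-idem _)))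
  ... | tri> _ _ dq<dp =
    unique q , uniqueProfile (Covers-swap cover) 0≤dq (trans (+-comm (d q) (d p)) dp+dq≡S) dq<dp
                 (trans dr≡min (p≥q⇒p⊓q≡q (+-monoʳ-≤ S (<⇒≤ dq<dp))))

dist : ℚ → ℚ → Fin 3 → ℚ
dist S x f = bdist S x (facilityPos S f)

cycDist : ℚ → ℚ → ℚ
cycDist S v = v ⊓ (ℚ[ 3 ] * S - v)

∣±v∣≡v : ∀ {u v} → 0ℚ ≤ v → u ≡ v ⊎ u ≡ - v → ∣ u ∣ ≡ v
∣±v∣≡v 0≤v (inj₁ refl) = 0≤p⇒∣p∣≡p 0≤v
∣±v∣≡v 0≤v (inj₂ refl) = trans (∣-p∣≡∣p∣ _) (0≤p⇒∣p∣≡p 0≤v)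

bdist≡cycDist : ∀ {S x p v} → 0ℚ ≤ v → x - p ≡ v ⊎ x - p ≡ - v → bdist S x p ≡ cycDist S v
bdist≡cycDist {S} 0≤v x-p≡±v = cong (λ z → z ⊓ (ℚ[ 3 ] * S - z)) (∣±v∣≡v 0≤v x-p≡±v)

cycDist-short : ∀ {S v} → 0ℚ ≤ v → v ≤ S → cycDist S v ≡ v
cycDist-short {S} {v} 0≤v v≤S =
  p≤q⇒p⊓q≡p (≤-witness (+-mono-≤ 0≤S-v (+-mono-≤ 0≤S-v (≤-trans 0≤v v≤S))) (eq S v))
  where
  0≤S-v : 0ℚ ≤ S - v
  0≤S-v = 0≤q-p v≤S
  eq : ∀ S v → ℚ[ 3 ] * S - v ≡ v + ((S - v) + ((S - v) + S))
  eq = solve-∀ ℚ-ring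

cycDist-reflect : ∀ {S} v w → v + w ≡ ℚ[ 3 ] * S → cycDist S v ≡ cycDist S w
cycDist-reflect {S} v w v+w≡3S = begin
  v ⊓ (ℚ[ 3 ] * S - v) ≡⟨ cong (λ z → v ⊓ (z - v)) (sym v+w≡3S) ⟩
  v ⊓ ((v + w) - v)     ≡⟨ cong (v ⊓_) (cancelˡ v w) ⟩
  v ⊓ w                 ≡⟨ ⊓-comm v w ⟩
  w ⊓ v                 ≡⟨ cong (w ⊓_) (cancelʳ v w) ⟨
  w ⊓ ((v + w) - w)     ≡⟨ cong (λ z → w ⊓ (z - w)) v+w≡3S ⟩
  w ⊓ (ℚ[ 3 ] * S - w) ∎
  where
  open ≡-Reasoning
  cancelˡ : ∀ v w → (v + w) - v ≡ w
  cancelˡ = solve-∀ ℚ-ring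
  cancelʳ : ∀ v w → (v + w) - w ≡ v
  cancelʳ = solve-∀ ℚ-ring

cycDist-long : ∀ S t → cycDist S (S + t) ≡ (S + t) ⊓ (S + (S - t))
cycDist-long S t = cong ((S + t) ⊓_) (eq S t)
  where
  eq : ∀ S t → ℚ[ 3 ] * S - (S + t) ≡ S + (S - t)
  eq = solve-∀ ℚ-ring

module _ {S x : ℚ} (0<S : 0ℚ < S) where

  private
    0≤S : 0ℚ ≤ S
    0≤S = <⇒≤ 0<S

  dist≡cycDist : ∀ f {v} → 0ℚ ≤ v → x - facilityPos S f ≡ v ⊎ x - facilityPos S f ≡ - v →
                 dist S x f ≡ cycDist S v
  dist≡cycDist f = bdist≡cycDist {S} {x} {facilityPos S f}

  dist-short : ∀ f {v} → 0ℚ ≤ v → v ≤ S → x - facilityPos S f ≡ v ⊎ x - facilityPos S f ≡ - v →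
               dist S x f ≡ v
  dist-short f 0≤v v≤S x-p≡±v = trans (dist≡cycDist f 0≤v x-p≡±v) (cycDist-short 0≤v v≤S)

  onSide : ∀ {p q r} → Covers p q r → ∀ {t} → 0ℚ ≤ t → t ≤ S →
           dist S x p ≡ t → dist S x q ≡ S - t → dist S x r ≡ cycDist S (S + t) →
           Σ Kind (Profile S (dist S x))
  onSide cover {t} 0≤t t≤S dp≡t dq≡S-t dr≡cycDist = sideProfile 0<S cover
    (subst (0ℚ ≤_) (sym dp≡t) 0≤t)
    (subst (0ℚ ≤_) (sym dq≡S-t) (0≤q-p t≤S))
    (trans (cong₂ _+_ dp≡t dq≡S-t) (eq S t))
    (trans dr≡cycDist (trans (cycDist-long S t) (cong₂ (λ a b → (S + a) ⊓ (S + b)) (sym dp≡t) (sym dq≡S-t))))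
    where
    eq : ∀ S t → t + (S - t) ≡ S
    eq = solve-∀ ℚ-ring

  side₀₁ : 0ℚ ≤ x → x ≤ S → Σ Kind (Profile S (dist S x))
  side₀₁ 0≤x x≤S = onSide cover 0≤x x≤S
    (dist-short zero 0≤x x≤S (inj₁ (eq₀ S x)))
    (dist-short (suc zero) (0≤q-p x≤S) (q-p≤q 0≤x) (inj₂ (eq₁ S x)))
    (trans (dist≡cycDist (suc (suc zero)) (+-mono-≤ 0≤S (0≤q-p x≤S)) (inj₂ (eq₂ S x)))
           (cycDist-reflect {S} (S + (S - x)) (S + x) (eq₃ S x)))
    where
    cover : Covers zero (suc zero) (suc (suc zero))
    cover zero             = inj₁ refl
    cover (suc zero)       = inj₂ (inj₁ refl)
    cover (suc (suc zero)) = inj₂ (inj₂ refl)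
    eq₀ : ∀ S x → x - ℚ[ 0 ] * S ≡ x
    eq₀ = solve-∀ ℚ-ring
    eq₁ : ∀ S x → x - ℚ[ 1 ] * S ≡ - (S - x)
    eq₁ = solve-∀ ℚ-ring
    eq₂ : ∀ S x → x - ℚ[ 2 ] * S ≡ - (S + (S - x))
    eq₂ = solve-∀ ℚ-ring
    eq₃ : ∀ S x → (S + (S - x)) + (S + x) ≡ ℚ[ 3 ] * S
    eq₃ = solve-∀ ℚ-ring

  side₁₂ : S ≤ x → x ≤ S + S → Σ Kind (Profile S (dist S x))
  side₁₂ S≤x x≤2S = onSide cover 0≤t t≤S
    (dist-short (suc zero) 0≤t t≤S (inj₁ (eq₁ S x)))
    (dist-short (suc (suc zero)) (0≤q-p t≤S) (q-p≤q 0≤t) (inj₂ (eq₂ S x)))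
    (dist≡cycDist zero (+-mono-≤ 0≤S 0≤t) (inj₁ (eq₀ S x)))
    where
    cover : Covers (suc zero) (suc (suc zero)) zero
    cover zero             = inj₂ (inj₂ refl)
    cover (suc zero)       = inj₁ refl
    cover (suc (suc zero)) = inj₂ (inj₁ refl)
    0≤t : 0ℚ ≤ x - S
    0≤t = 0≤q-p S≤x
    t≤S : x - S ≤ S
    t≤S = p-q≤r x≤2S
    eq₀ : ∀ S x → x - ℚ[ 0 ] * S ≡ S + (x - S)
    eq₀ = solve-∀ ℚ-ring
    eq₁ : ∀ S x → x - ℚ[ 1 ] * S ≡ x - S
    eq₁ = solve-∀ ℚ-ring
    eq₂ : ∀ S x → x - ℚ[ 2 ] * S ≡ - (S - (x - S))
    eq₂ = solve-∀ ℚ-ring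

  side₂₀ : S + S ≤ x → x < ℚ[ 3 ] * S → Σ Kind (Profile S (dist S x))
  side₂₀ 2S≤x x<3S = onSide cover 0≤t t≤S
    (dist-short (suc (suc zero)) 0≤t t≤S (inj₁ (eq₂ S x)))
    (trans (dist≡cycDist zero (+-mono-≤ (+-mono-≤ 0≤S 0≤S) 0≤t) (inj₁ (eq₀ S x)))
           (trans (cycDist-reflect {S} ((S + S) + (x - (S + S))) (S - (x - (S + S))) (eq₃ S x))
                  (cycDist-short {S} (0≤q-p t≤S) (q-p≤q 0≤t))))
    (dist≡cycDist (suc zero) (+-mono-≤ 0≤S 0≤t) (inj₁ (eq₁ S x)))
    where
    cover : Covers (suc (suc zero)) zero (suc zero)
    cover zero             = inj₂ (inj₁ refl)
    cover (suc zero)       = inj₂ (inj₂ refl)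
    cover (suc (suc zero)) = inj₁ refl
    eq₀ : ∀ S x → x - ℚ[ 0 ] * S ≡ (S + S) + (x - (S + S))
    eq₀ = solve-∀ ℚ-ring
    eq₁ : ∀ S x → x - ℚ[ 1 ] * S ≡ S + (x - (S + S))
    eq₁ = solve-∀ ℚ-ring
    eq₂ : ∀ S x → x - ℚ[ 2 ] * S ≡ x - (S + S)
    eq₂ = solve-∀ ℚ-ring
    eq₃ : ∀ S x → ((S + S) + (x - (S + S))) + (S - (x - (S + S))) ≡ ℚ[ 3 ] * S
    eq₃ = solve-∀ ℚ-ring
    eq₄ : ∀ S → ℚ[ 3 ] * S ≡ (S + S) + S
    eq₄ = solve-∀ ℚ-ring
    0≤t : 0ℚ ≤ x - (S + S)
    0≤t = 0≤q-p 2S≤x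
    t≤S : x - (S + S) ≤ S
    t≤S = p-q≤r (≤-trans (<⇒≤ x<3S) (≤-reflexive (eq₄ S)))

boundaryProfile : ∀ {S x} → 0ℚ < S → OnBoundary S x → Σ Kind (Profile S (dist S x))
boundaryProfile {S} {x} 0<S (0≤x , x<3S) with ≤-total x S
... | inj₁ x≤S = side₀₁ 0<S 0≤x x≤S
... | inj₂ S≤x with ≤-total x (S + S)
...   | inj₁ x≤2S = side₁₂ 0<S S≤x x≤2S
...   | inj₂ 2S≤x = side₂₀ 0<S 2S≤x x<3S

χ : Bool → ℕ
χ true  = 1
χ false = 0

Loads : Set
Loads = ℕ × ℕ × ℕ

at : Loads → Fin 3 → ℕ
at (a , _ , _) zero             = a
at (_ , b , _) (suc zero)       = b
at (_ , _ , c) (suc (suc zero)) = c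

bump : Fin 3 → Loads → Loads
bump zero             (a , b , c) = suc a , b , c
bump (suc zero)       (a , b , c) = a , suc b , c
bump (suc (suc zero)) (a , b , c) = a , b , suc c

Free : Loads → Fin 3 → Set
Free a f = at a f ℕ.< 2

GreedyMay : Kind → Loads → Fin 3 → Set
GreedyMay k a g = Free a g × (∀ f → T (near k f) → Free a f → T (near k g))

-- ψ a b is the largest value of (greedy detours - 2 × costly assignments) that can still arise
-- from greedy loads a and optimal loads b; it was found by exhaustive search, and only the
-- one-step inequality PotentialStep is checked here. ψ-row a₀ a₁ a₂ lists ψ (a₀ , a₁ , a₂) b as
-- the digits of a 27-digit numeral, for b ∈ {0,1,2}³ in lexicographic order.
ψ-row : ℕ → ℕ → ℕ → ℕ
ψ-row 0 0 0 = 000000000000000000000000000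
ψ-row 0 0 1 = 200200200200100100200100100
ψ-row 0 0 2 = 420420420420310310420310210
ψ-row 0 1 0 = 222000000211000000211000000
ψ-row 0 1 1 = 322200200321200100321200100
ψ-row 0 1 2 = 331320320331320310331320210
ψ-row 0 2 0 = 444222000433211000432211000
ψ-row 0 2 1 = 333322100333321100332321100
ψ-row 0 2 2 = 222221210222221210222221210
ψ-row 1 0 0 = 222211211000000000000000000
ψ-row 1 0 1 = 322321321200200200200100100
ψ-row 1 0 2 = 331331331320320320320310210
ψ-row 1 1 0 = 333222211222000000211000000
ψ-row 1 1 1 = 222222221222200200221200100
ψ-row 1 1 2 = 221221221221220220221220210
ψ-row 1 2 0 = 333333111333222000332211000
ψ-row 1 2 1 = 222222111222222100222221100
ψ-row 1 2 2 = 111111110111111110111111110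
ψ-row 2 0 0 = 444433432222211211000000000
ψ-row 2 0 1 = 333333332322321321100100100
ψ-row 2 0 2 = 222222222221221221210210210
ψ-row 2 1 0 = 333333332333222211111000000
ψ-row 2 1 1 = 222222222222222221111100100
ψ-row 2 1 2 = 111111111111111111110110110
ψ-row 2 2 0 = 222222222222222111222111000
ψ-row 2 2 1 = 111111111111111111111111000
ψ-row 2 2 2 = 000000000000000000000000000
ψ-row _ _ _ = 0

digit : ℕ → ℕ → ℕ
digit n zero    = n % 10
digit n (suc k) = digit (n / 10) k

ψ : Loads → Loads → ℕ
ψ (a₀ , a₁ , a₂) (b₀ , b₁ , b₂) = digit (ψ-row a₀ a₁ a₂) (26 ℕ.∸ (9 ℕ.* b₀ ℕ.+ 3 ℕ.* b₁ ℕ.+ b₂))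

PotentialStep : Loads → Loads → Kind → Fin 3 → Fin 3 → Set
PotentialStep a b k g o =
  GreedyMay k a g → Free b o →
  χ (not (near k g)) ℕ.+ ψ (bump g a) (bump o b) ℕ.≤ (χ (costly k o) ℕ.+ χ (costly k o)) ℕ.+ ψ a b

potentialStep? : ∀ a b k g o → Dec (PotentialStep a b k g o)
potentialStep? a b k g o =
  ((at a g ℕ.<? 2) ×-dec all? (λ f → T? (near k f) →-dec ((at a f ℕ.<? 2) →-dec T? (near k g))))
    →-dec ((at b o ℕ.<? 2) →-dec (_ ℕ.≤? _))

allKinds? : ∀ {P : Kind → Set} → Decidable P → Dec (∀ k → P k)
allKinds? {P} P? = map′ every split (all? λ f → P? (unique f) ×-dec P? (midpoint f))
  where
  every : (∀ f → P (unique f) × P (midpoint f)) → ∀ k → P k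
  every both (unique f)   = proj₁ (both f)
  every both (midpoint f) = proj₂ (both f)
  split : (∀ k → P k) → ∀ f → P (unique f) × P (midpoint f)
  split every′ f = every′ (unique f) , every′ (midpoint f)

potentialStep-table : ∀ (a₀ a₁ a₂ b₀ b₁ b₂ : Fin 3) k g o →
                      PotentialStep (toℕ a₀ , toℕ a₁ , toℕ a₂) (toℕ b₀ , toℕ b₁ , toℕ b₂) k g o
potentialStep-table = toWitness {a? = all? λ a₀ → all? λ a₁ → all? λ a₂ → all? λ b₀ → all? λ b₁ → all? λ b₂ →
  allKinds? λ k → all? λ g → all? λ o → potentialStep? _ _ k g o} _

Bounded : Loads → Set
Bounded (a₀ , a₁ , a₂) = a₀ ℕ.≤ 2 × a₁ ℕ.≤ 2 × a₂ ℕ.≤ 2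

≤2-elim : ∀ {P : ℕ → Set} → (∀ i → P (toℕ {3} i)) → ∀ {n} → n ℕ.≤ 2 → P n
≤2-elim h z≤n             = h zero
≤2-elim h (s≤s z≤n)       = h (suc zero)
≤2-elim h (s≤s (s≤s z≤n)) = h (suc (suc zero))

Bounded-elim : ∀ {P : Loads → Set} → (∀ i₀ i₁ i₂ → P (toℕ i₀ , toℕ i₁ , toℕ i₂)) → ∀ a → Bounded a → P a
Bounded-elim {P} h (a₀ , a₁ , a₂) (a₀≤2 , a₁≤2 , a₂≤2) =
  ≤2-elim {λ n → P (n , a₁ , a₂)} (λ i₀ →
    ≤2-elim {λ n → P (toℕ i₀ , n , a₂)} (λ i₁ →
      ≤2-elim {λ n → P (toℕ i₀ , toℕ i₁ , n)} (h i₀ i₁) a₂≤2) a₁≤2) a₀≤2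

potentialStep : ∀ a b → Bounded a → Bounded b → ∀ k g o → PotentialStep a b k g o
potentialStep a b a≤2 b≤2 =
  Bounded-elim {λ a → ∀ b → Bounded b → ∀ k g o → PotentialStep a b k g o}
    (λ a₀ a₁ a₂ → Bounded-elim (potentialStep-table a₀ a₁ a₂)) a a≤2 b b≤2

loads : List (Fin 3) → Loads
loads h = load zero h , load (suc zero) h , load (suc (suc zero)) h

loads-∷ : ∀ g h → loads (g ∷ h) ≡ bump g (loads h)
loads-∷ zero             h = refl
loads-∷ (suc zero)       h = refl
loads-∷ (suc (suc zero)) h = refl

at-loads : ∀ h f → at (loads h) f ≡ load f h
at-loads h zero             = refl
at-loads h (suc zero)       = refl
at-loads h (suc (suc zero)) = refl

load-here : ∀ f h → load f (f ∷ h) ≡ suc (load f h)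
load-here f h with f ≟ f
... | yes _  = refl
... | no f≢f = ⊥-elim (f≢f refl)

load-shift : ∀ f o oh os → load f (o ∷ oh) ℕ.+ load f os ≡ load f oh ℕ.+ load f (o ∷ os)
load-shift f o oh os with f ≟ o
... | yes _ = sym (ℕ.+-suc (load f oh) (load f os))
... | no _  = refl

load-∷-≤ : ∀ {g h} → Available h g → (∀ f → load f h ℕ.≤ 2) → ∀ f → load f (g ∷ h) ℕ.≤ 2
load-∷-≤ {g} avail h≤2 f with f ≟ g
... | yes refl = avail
... | no _     = h≤2 f

Φ : List (Fin 3) → List (Fin 3) → ℕ
Φ gh oh = ψ (loads gh) (loads oh)

potentialDrops : ∀ {k gh oh g o} → (∀ f → load f gh ℕ.≤ 2) → (∀ f → load f oh ℕ.≤ 2) →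
                 Available gh g → (∀ f → T (near k f) → Available gh f → T (near k g)) → Available oh o →
                 χ (not (near k g)) ℕ.+ Φ (g ∷ gh) (o ∷ oh) ℕ.≤ (χ (costly k o) ℕ.+ χ (costly k o)) ℕ.+ Φ gh oh
potentialDrops {k} {gh} {oh} {g} {o} gh≤2 oh≤2 avail-g prefers avail-o =
  subst (λ z → χ (not (near k g)) ℕ.+ z ℕ.≤ _) (sym (cong₂ ψ (loads-∷ g gh) (loads-∷ o oh)))
    (potentialStep (loads gh) (loads oh) (bounded {gh} gh≤2) (bounded {oh} oh≤2) k g o
      (free gh avail-g , λ f near-f free-f → prefers f near-f (available gh free-f))
      (free oh avail-o))
  where
  bounded : ∀ {h} → (∀ f → load f h ℕ.≤ 2) → Bounded (loads h)
  bounded h≤2 = h≤2 zero , h≤2 (suc zero) , h≤2 (suc (suc zero))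
  free : ∀ h {f} → Available h f → Free (loads h) f
  free h {f} = subst (ℕ._< 2) (sym (at-loads h f))
  available : ∀ h {f} → Free (loads h) f → Available h f
  available h {f} = subst (ℕ._< 2) (at-loads h f)

·-nonneg : ∀ {S} → 0ℚ ≤ S → ∀ n → 0ℚ ≤ n · S
·-nonneg 0≤S zero    = ≤-refl
·-nonneg 0≤S (suc n) = +-mono-≤ 0≤S (·-nonneg 0≤S n)

·-monoˡ-≤ : ∀ {S} → 0ℚ ≤ S → ∀ {m n} → m ℕ.≤ n → m · S ≤ n · S
·-monoˡ-≤ 0≤S       (z≤n {n})   = ·-nonneg 0≤S n
·-monoˡ-≤ {S} 0≤S (s≤s m≤n) = +-monoʳ-≤ S (·-monoˡ-≤ 0≤S m≤n)

module _ {S : ℚ} {d : Fin 3 → ℚ} {k : Kind} (P : Profile S d k) where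

  open Profile P

  radius≤ : ∀ f → radius ≤ d f
  radius≤ f with near k f | near⇒≡radius f | far⇒radius< f
  ... | true  | d≡radius | _        = ≤-reflexive (sym (d≡radius tt))
  ... | false | _        | radius<d = <⇒≤ (radius<d tt)

  greedyPrefersNear : ∀ {gh g} → (∀ h → Available gh h → d g ≤ d h) →
                      ∀ h → T (near k h) → Available gh h → T (near k g)
  greedyPrefersNear {g = g} closest h near-h avail-h with near k g | far⇒radius< g
  ... | true  | _        = tt
  ... | false | radius<d = ⊥-elim (<-irrefl refl
    (<-≤-trans (radius<d tt) (≤-trans (closest h avail-h) (≤-reflexive (near⇒≡radius h near-h)))))

  greedyUpperBound : ∀ g → d g ≤ radius + χ (not (near k g)) · S
  greedyUpperBound g with near k g | near⇒≡radius g
  ... | true  | d≡radius = ≤-reflexive (trans (d≡radius tt) (sym (+-identityʳ radius)))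
  ... | false | _        = subst (λ z → d g ≤ radius + z) (sym (+-identityʳ S)) (≤radius+S g)

  assignmentLowerBound : ∀ o → radius + (χ (costly k o) ℕ.+ χ (costly k o)) · S ≤ ℚ[ 5 ] * d o
  assignmentLowerBound o = begin
    radius + (χ (costly k o) ℕ.+ χ (costly k o)) · S ≤⟨ +-mono-≤ (radius≤ o) costlyPart ⟩
    d o + ((d o + d o) + (d o + d o))                ≡⟨ eq (d o) ⟩
    ℚ[ 5 ] * d o                                     ∎
    where
    open ≤-Reasoning
    eq : ∀ y → y + ((y + y) + (y + y)) ≡ ℚ[ 5 ] * y
    eq = solve-∀ ℚ-ring
    0≤d : 0ℚ ≤ d o
    0≤d = ≤-trans 0≤radius (radius≤ o)
    costlyPart : (χ (costly k o) ℕ.+ χ (costly k o)) · S ≤ (d o + d o) + (d o + d o)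
    costlyPart with costly k o | costly⇒S≤d+d o
    ... | true  | S≤d+d = +-mono-≤ (S≤d+d tt) (subst (_≤ d o + d o) (sym (+-identityʳ S)) (S≤d+d tt))
    ... | false | _     = +-mono-≤ (+-mono-≤ 0≤d 0≤d) (+-mono-≤ 0≤d 0≤d)

  amortizedCost : 0ℚ ≤ S → ∀ {g o Φ Φ′} →
                  χ (not (near k g)) ℕ.+ Φ′ ℕ.≤ (χ (costly k o) ℕ.+ χ (costly k o)) ℕ.+ Φ →
                  d g + Φ′ · S ≤ ℚ[ 5 ] * d o + Φ · S
  amortizedCost 0≤S {g} {o} {Φ} {Φ′} drop = begin
    d g + Φ′ · S                      ≤⟨ +-monoˡ-≤ (Φ′ · S) (greedyUpperBound g) ⟩
    (radius + b · S) + Φ′ · S         ≡⟨ +-assoc radius (b · S) (Φ′ · S) ⟩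
    radius + (b · S + Φ′ · S)         ≡⟨ cong (radius +_) (×-homo-+ S b Φ′) ⟨
    radius + (b ℕ.+ Φ′) · S           ≤⟨ +-monoʳ-≤ radius (·-monoˡ-≤ 0≤S drop) ⟩
    radius + (c ℕ.+ c ℕ.+ Φ) · S      ≡⟨ cong (radius +_) (×-homo-+ S (c ℕ.+ c) Φ) ⟩
    radius + ((c ℕ.+ c) · S + Φ · S)  ≡⟨ +-assoc radius ((c ℕ.+ c) · S) (Φ · S) ⟨
    (radius + (c ℕ.+ c) · S) + Φ · S  ≤⟨ +-monoˡ-≤ (Φ · S) (assignmentLowerBound o) ⟩
    ℚ[ 5 ] * d o + Φ · S              ∎
    where
    open ≤-Reasoning
    b c : ℕ
    b = χ (not (near k g))
    c = χ (costly k o)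

module _ {S : ℚ} (0<S : 0ℚ < S) where

  amortizedRatio : ∀ {gh oh} xs gs os → All (OnBoundary S) xs → IsGreedy S gh xs gs → length os ≡ length xs →
              (∀ f → load f gh ℕ.≤ 2) → (∀ f → load f oh ℕ.+ load f os ℕ.≤ 2) →
              cost S xs gs ≤ ℚ[ 5 ] * cost S xs os + Φ gh oh · S
  amortizedRatio {gh} {oh} [] [] [] _ _ _ _ _ =
    subst (0ℚ ≤_) (sym (+-identityˡ (Φ gh oh · S))) (·-nonneg (<⇒≤ 0<S) (Φ gh oh))
  amortizedRatio {gh} {oh} (x ∷ xs) (g ∷ gs) (o ∷ os) (onBoundary ∷ onBoundaries) (avail-g , closest , greedy)
            len gh≤2 oh+os≤2 with boundaryProfile 0<S onBoundary
  ... | k , P = begin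
    dist S x g + cost S xs gs                                   ≤⟨ +-monoʳ-≤ (dist S x g) IH ⟩
    dist S x g + (ℚ[ 5 ] * cost S xs os + Φ′ · S)               ≡⟨ reorder (dist S x g) _ (Φ′ · S) ⟩
    (dist S x g + Φ′ · S) + ℚ[ 5 ] * cost S xs os               ≤⟨ +-monoˡ-≤ _ (amortizedCost P (<⇒≤ 0<S) {g} {o} step) ⟩
    (ℚ[ 5 ] * dist S x o + Φ gh oh · S) + ℚ[ 5 ] * cost S xs os ≡⟨ collect (dist S x o) (Φ gh oh · S) (cost S xs os) ⟩
    ℚ[ 5 ] * (dist S x o + cost S xs os) + Φ gh oh · S          ∎
    where
    open ≤-Reasoning
    reorder : ∀ a b c → a + (b + c) ≡ (a + c) + b
    reorder = solve-∀ ℚ-ring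
    collect : ∀ a b c → (ℚ[ 5 ] * a + b) + ℚ[ 5 ] * c ≡ ℚ[ 5 ] * (a + c) + b
    collect = solve-∀ ℚ-ring
    Φ′ : ℕ
    Φ′ = Φ (g ∷ gh) (o ∷ oh)
    oh≤2 : ∀ f → load f oh ℕ.≤ 2
    oh≤2 f = ℕ.m+n≤o⇒m≤o (load f oh) (oh+os≤2 f)
    o∷oh+os≤2 : ∀ f → load f (o ∷ oh) ℕ.+ load f os ℕ.≤ 2
    o∷oh+os≤2 f = subst (ℕ._≤ 2) (sym (load-shift f o oh os)) (oh+os≤2 f)
    avail-o : Available oh o
    avail-o = subst (ℕ._≤ 2) (load-here o oh) (ℕ.m+n≤o⇒m≤o (load o (o ∷ oh)) (o∷oh+os≤2 o))
    step : χ (not (near k g)) ℕ.+ Φ′ ℕ.≤ (χ (costly k o) ℕ.+ χ (costly k o)) ℕ.+ Φ gh oh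
    step = potentialDrops {k} {gh} {oh} {g} {o} gh≤2 oh≤2 avail-g (greedyPrefersNear P {gh} {g} closest) avail-o
    IH : cost S xs gs ≤ ℚ[ 5 ] * cost S xs os + Φ′ · S
    IH = amortizedRatio xs gs os onBoundaries greedy (ℕ.suc-injective len) (load-∷-≤ avail-g gh≤2) o∷oh+os≤2

mainTheorem3 : (S : ℚ) → 0ℚ < S →
    (xs : List ℚ) → length xs ℕ.≤ 6 → All (OnBoundary S) xs →
    (gs : List (Fin 3)) → IsGreedy S [] xs gs →
    (os : List (Fin 3)) → length os ≡ length xs → Feasible os →
    cost S xs gs ≤ ℚ[ 5 ] * cost S xs os
mainTheorem3 S 0<S xs _ onBoundary gs greedy os len feasible =
  subst (cost S xs gs ≤_) (+-identityʳ _)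
    (amortizedRatio 0<S {[]} {[]} xs gs os onBoundary greedy len (λ _ → z≤n) feasible)
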